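{- Let $t \geq 3$, $k = t-1$, and $n \geq 2k^2+4k$. Consider the Zeckendorf game on $n$ with $p = tk$ players divided into $t$ teams, where each team consists of exactly $k$ consecutive players. Then no team has a winning strategy.
   Context: Let $F_1=1$, $F_2=2$, $F_{i+1}=F_i+F_{i-1}$. The Zeckendorf game on $n$ starts with the multiset of $n$ copies of $1$. A move is one of: if the list contains $F_{i-1}$ and $F_i$, replace them by $F_{i+1}$; if the list contains two copies of $F_i$: for $i=1$ replace them by $F_2$; for $i=2$ replace them by $F_1,F_3$; for $i\geq 3$ replace them by $F_{i-2},F_{i+1}$. The game ends when the list is the Zeckendorf decomposition of $n$ (distinct, pairwise non-consecutive Fibonacci numbers); every game terminates. With $p$ players, players $1,\dots,p$ move in cyclic order $1,2,\dots,p,1,2,\dots$ starting with player 1; players $i$ and $i+1 \pmod p$ are consecutive (in particular $p$ and $1$ are consecutive). Players are partitioned into teams (alliances); a team wins if the final move (creating the Zeckendorf decomposition) is made by one of its members. A team has a winning strategy if its members can choose their moves so that the final move is made by a member of the team no matter what moves the other players make. -}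

module Defs where

open import Data.Nat using (ℕ; zero; suc; _+_; _*_; _∸_; _≤_; _<_)
open import Data.Nat.Properties using (_≟_)
open import Data.Bool using (if_then_else_)
open import Data.Product using (Σ; ∃; _×_; _,_)
open import Data.Sum using (_⊎_)
open import Relation.Nullary using (¬_; does)
open import Relation.Binary.PropositionalEquality using (_≡_)
open import Function.Bundles using (_⇔_)

-- Fibonacci numbers with the paper's indexing: F 1 = 1, F 2 = 2, F (i+1) = F i + F (i-1).
-- (F 0 is an unused auxiliary value.)
F : ℕ → ℕ
F zero = 1
F (suc zero) = 1
F (suc (suc zero)) = 2
F (suc (suc (suc i))) = F (suc (suc i)) + F (suc i)

-- A game position (a multiset of Fibonacci numbers) is represented by its
-- multiplicity function: c i = number of copies of F i in the list (i ≥ 1).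
Position : Set
Position = ℕ → ℕ

δ : ℕ → ℕ → ℕ
δ i j = if does (i ≟ j) then 1 else 0

-- c' is obtained from c by removing the multiset r and adding the multiset a
-- (c' j + r j ≡ c j + a j forces r ≤ c on the support of r, since r and a
--  have disjoint supports in all moves below).
Step : Position → Position → (ℕ → ℕ) → (ℕ → ℕ) → Set
Step c c' r a = ∀ j → c' j + r j ≡ c j + a j

data Move (c c' : Position) : Set where
  combine : ∀ m → 1 ≤ m → Step c c' (λ j → δ m j + δ (suc m) j) (δ (suc (suc m))) → Move c c'
  split1  : Step c c' (λ j → 2 * δ 1 j) (δ 2) → Move c c'
  split2  : Step c c' (λ j → 2 * δ 2 j) (λ j → δ 1 j + δ 3 j) → Move c c'
  splitHi : ∀ i → 3 ≤ i → Step c c' (λ j → 2 * δ i j) (λ j → δ (i ∸ 2) j + δ (suc i) j) → Move c c'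

Zeck : Position → Set
Zeck c = (∀ j → c j ≤ 1) × (∀ j → c j + c (suc j) ≤ 1)

start : ℕ → Position
start n j = n * δ 1 j

-- players are labelled 0,…,p-1 (label 0 = player 1); cyclic successor
next : ℕ → ℕ → ℕ
next p j = if does (suc j ≟ p) then 0 else suc j

-- Win p T c j : in position c with player j to move, the team T (a predicate
-- on player labels) can force the final move (the one producing the
-- Zeckendorf decomposition) to be made by one of its members.
-- Since every game terminates, an inductive (well-founded) definition of
-- forcing is the same as having a winning strategy.
data Win (p : ℕ) (T : ℕ → Set) : Position → ℕ → Set where
  ours   : ∀ {c j} → ¬ Zeck c → T j → (c' : Position) → Move c c' →
           (Zeck c' ⊎ Win p T c' (next p j)) → Win p T c j
  theirs : ∀ {c j} → ¬ Zeck c → ¬ T j →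
           (∀ c' → Move c c' → Win p T c' (next p j)) → Win p T c j

ConsecBlock : ℕ → ℕ → (ℕ → Set) → Set
ConsecBlock p k S = Σ ℕ λ a → a < p × (∀ j → j < p →
  (S j ⇔ (Σ ℕ λ i → i < k × (j ≡ a + i ⊎ j + p ≡ a + i))))

{-# OPTIONS --safe #-}
-- Strategy stealing. Number the players by their place after the first member of
-- the team, so that the team holds places 0, …, k - 1. Suppose the player at place k
-- is to move and at least 3k + 1 copies of F 1 remain. The opponents at places
-- k, …, 4k - 1 can turn 3k copies of F 1 into k copies of F 3 either in 2k moves
-- (F1 F1 ↦ F2, F1 F2 ↦ F3) or in 3k moves (F1 F1 ↦ F2 twice, F2 F2 ↦ F1 F3). Both
-- lead to the same position, with players k places apart to move. If the team won
-- from both, playing the two games in lockstep would let it make the final move in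
-- both, yet two players k places apart are never both in the team. From the start
-- the game reaches place k with enough copies of F 1 left, as n ≥ 2k² + 4k ≥ p + 4k + 2:
-- the opponents can move using up about one F 1 per move, the team at most two.
-- For t = 3 only four opponents sit in a row. They fork with two moves against four
-- instead, which needs an F 3 or two F 2's, and a case analysis of the team's two
-- moves shows that they cannot keep the opponents from such a position for long.

module Submission where

open import Defs
open import Data.Nat using (ℕ; zero; suc; _+_; _*_; _∸_; _≤_; _<_; z≤n; s≤s; z<s; _≤?_; _≡ᵇ_)
open import Data.Nat.Properties
open import Data.Nat.GeneralisedArithmetic using (iterate)
open import Data.Product using (Σ; _×_; _,_; proj₁; proj₂)
open import Data.Sum using (_⊎_; inj₁; inj₂) renaming (map to ⊎-map)
open import Data.Bool as Bool using (true; false)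
open import Data.Empty using (⊥; ⊥-elim)
open import Function.Base using (_∘_)
open import Relation.Nullary using (¬_; yes; no)
open import Relation.Binary.PropositionalEquality
open import Function.Bundles using (Equivalence)
open import Data.Nat.Tactic.RingSolver using (solve-∀)

private
  variable
    c c′ d d′ e : Position
    a i j j₁ j₂ m n p u ρ : ℕ

-- Positions and moves

δ-refl : ∀ i → δ i i ≡ 1
δ-refl zero = refl
δ-refl (suc i) = δ-refl i

δ-≢ : i ≢ j → δ i j ≡ 0
δ-≢ {zero} {zero} i≢j = ⊥-elim (i≢j refl)
δ-≢ {zero} {suc j} _ = refl
δ-≢ {suc i} {zero} _ = refl
δ-≢ {suc i} {suc j} i≢j = δ-≢ (i≢j ∘ cong suc)

δ-< : i < j → δ i j ≡ 0
δ-< = δ-≢ ∘ <⇒≢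

δ-> : j < i → δ i j ≡ 0
δ-> = δ-≢ ∘ >⇒≢

δ≤1 : ∀ i j → δ i j ≤ 1
δ≤1 i j with i ≟ j
... | yes refl = ≤-reflexive (δ-refl i)
... | no i≢j = ≤-trans (≤-reflexive (δ-≢ i≢j)) z≤n

δ-adjacent : ∀ i j → δ i j + δ i (suc j) ≤ 1
δ-adjacent zero zero = s≤s z≤n
δ-adjacent zero (suc j) = z≤n
δ-adjacent (suc i) zero = δ≤1 i zero
δ-adjacent (suc i) (suc j) = δ-adjacent i j

_[_↦_] : Position → (ℕ → ℕ) → (ℕ → ℕ) → Position
(c [ r ↦ a ]) j = a j + (c j ∸ r j)

↦-cong : ∀ {r a} → c ≗ d → c [ r ↦ a ] ≗ d [ r ↦ a ]
↦-cong {r = r} {a} c≗d j = cong (λ x → a j + (x ∸ r j)) (c≗d j)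

↦-step : ∀ r a → (∀ j → r j ≤ c j) → Step c (c [ r ↦ a ]) r a
↦-step {c} r a r≤c j = begin
  a j + (c j ∸ r j) + r j   ≡⟨ +-assoc (a j) _ _ ⟩
  a j + (c j ∸ r j + r j)   ≡⟨ cong (a j +_) (m∸n+n≡m (r≤c j)) ⟩
  a j + c j                 ≡⟨ +-comm (a j) (c j) ⟩
  c j + a j                 ∎
  where open ≡-Reasoning

step-≗ : ∀ {r a} → Step c c′ r a → (∀ j → r j ≤ c j) → c′ ≗ c [ r ↦ a ]
step-≗ {r = r} {a} st r≤c j =
  +-cancelʳ-≡ (r j) _ _ (trans (st j) (sym (↦-step r a r≤c j)))

step-removes-present : ∀ {r a} → Step c c′ r a → (∀ j → r j ≡ 0 ⊎ a j ≡ 0) → ∀ j → r j ≤ c j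
step-removes-present {c} {c′} {r} st disjoint j with disjoint j
... | inj₁ r≡0 = ≤-trans (≤-reflexive r≡0) z≤n
... | inj₂ a≡0 = ≤-trans (m≤n+m (r j) (c′ j))
  (≤-reflexive (trans (st j) (trans (cong (c j +_) a≡0) (+-identityʳ (c j)))))

split₁ split₂ : Position → Position
split₁ c = c [ (λ j → 2 * δ 1 j) ↦ δ 2 ]
split₂ c = c [ (λ j → 2 * δ 2 j) ↦ (λ j → δ 1 j + δ 3 j) ]

split merge : ℕ → Position → Position
split i c = c [ (λ j → 2 * δ i j) ↦ (λ j → δ (i ∸ 2) j + δ (suc i) j) ]
merge m c = c [ (λ j → δ m j + δ (suc m) j) ↦ δ (suc (suc m)) ]

twice-δ≤ : 2 ≤ c i → ∀ j → 2 * δ i j ≤ c j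
twice-δ≤ {i = i} 2≤ci j with i ≟ j
... | yes refl = ≤-trans (≤-reflexive (cong (2 *_) (δ-refl i))) 2≤ci
... | no i≢j = ≤-trans (≤-reflexive (cong (2 *_) (δ-≢ i≢j))) z≤n

pair-δ≤ : 1 ≤ c m → 1 ≤ c (suc m) → ∀ j → δ m j + δ (suc m) j ≤ c j
pair-δ≤ {m = m} 1≤cm 1≤cm+1 j with m ≟ j | suc m ≟ j
... | yes refl | yes m+1≡m = ⊥-elim (1+n≢n m+1≡m)
... | yes refl | no m+1≢m rewrite δ-refl m | δ-≢ m+1≢m = 1≤cm
... | no m≢j | yes refl rewrite δ-refl (suc m) | δ-≢ m≢j = 1≤cm+1
... | no m≢j | no m+1≢j rewrite δ-≢ m≢j | δ-≢ m+1≢j = z≤n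

split₁-move : 2 ≤ c 1 → Move c (split₁ c)
split₁-move {c} 2≤c1 = split1 (↦-step {c} _ (δ 2) (twice-δ≤ 2≤c1))

split₂-move : 2 ≤ c 2 → Move c (split₂ c)
split₂-move {c} 2≤c2 = split2 (↦-step {c} _ (λ j → δ 1 j + δ 3 j) (twice-δ≤ 2≤c2))

split-move : 3 ≤ i → 2 ≤ c i → Move c (split i c)
split-move {i} {c} 3≤i 2≤ci = splitHi i 3≤i (↦-step {c} _ (λ j → δ (i ∸ 2) j + δ (suc i) j) (twice-δ≤ 2≤ci))

merge-move : 1 ≤ m → 1 ≤ c m → 1 ≤ c (suc m) → Move c (merge m c)
merge-move {m} {c} 1≤m 1≤cm 1≤cm+1 = combine m 1≤m (↦-step {c} _ (δ (suc (suc m))) (pair-δ≤ 1≤cm 1≤cm+1))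

data MoveView (c c′ : Position) : Set where
  by-merge : ∀ m → 1 ≤ m → 1 ≤ c m → 1 ≤ c (suc m) → c′ ≗ merge m c → MoveView c c′
  by-split₁ : 2 ≤ c 1 → c′ ≗ split₁ c → MoveView c c′
  by-split₂ : 2 ≤ c 2 → c′ ≗ split₂ c → MoveView c c′
  by-split : ∀ i → 3 ≤ i → 2 ≤ c i → c′ ≗ split i c → MoveView c c′

merge-disjoint : ∀ m j → δ m j + δ (suc m) j ≡ 0 ⊎ δ (suc (suc m)) j ≡ 0
merge-disjoint m j with suc (suc m) ≟ j
... | yes refl = inj₁ (cong₂ _+_ (δ-< {m} (m≤n⇒m≤1+n ≤-refl)) (δ-< {suc m} ≤-refl))
... | no m+2≢j = inj₂ (δ-≢ m+2≢j)

split-disjoint : 3 ≤ i → ∀ j → 2 * δ i j ≡ 0 ⊎ δ (i ∸ 2) j + δ (suc i) j ≡ 0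
split-disjoint {suc zero} (s≤s ()) j
split-disjoint {suc (suc zero)} (s≤s (s≤s ())) j
split-disjoint {suc (suc (suc i))} _ j with suc (suc (suc i)) ≟ j
... | yes refl = inj₂ (cong₂ _+_ (δ-< {suc i} (s≤s (n≤1+n (suc i))))
                                (δ-> {suc (suc (suc i))} {suc (suc (suc (suc i)))} ≤-refl))
... | no i≢j = inj₁ (cong (2 *_) (δ-≢ i≢j))

split₁-disjoint : ∀ j → 2 * δ 1 j ≡ 0 ⊎ δ 2 j ≡ 0
split₁-disjoint zero = inj₁ refl
split₁-disjoint (suc zero) = inj₂ refl
split₁-disjoint (suc (suc j)) = inj₁ refl

split₂-disjoint : ∀ j → 2 * δ 2 j ≡ 0 ⊎ δ 1 j + δ 3 j ≡ 0
split₂-disjoint zero = inj₁ refl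
split₂-disjoint (suc zero) = inj₁ refl
split₂-disjoint (suc (suc zero)) = inj₂ refl
split₂-disjoint (suc (suc (suc j))) = inj₁ refl

twice-δ≤-at : (∀ j → 2 * δ i j ≤ c j) → 2 ≤ c i
twice-δ≤-at {i} le = ≤-trans (≤-reflexive (cong (2 *_) (sym (δ-refl i)))) (le i)

move-view : Move c c′ → MoveView c c′
move-view {c} {c′} (combine m 1≤m st) = by-merge m 1≤m 1≤cm 1≤cm+1 (step-≗ st removed≤c)
  where
    removed≤c = step-removes-present {c′ = c′} st (merge-disjoint m)
    1≤cm : 1 ≤ c m
    1≤cm = ≤-trans (≤-trans (≤-reflexive (sym (δ-refl m))) (m≤m+n _ _)) (removed≤c m)
    1≤cm+1 : 1 ≤ c (suc m)
    1≤cm+1 = ≤-trans (≤-trans (≤-reflexive (sym (δ-refl (suc m)))) (m≤n+m _ _)) (removed≤c (suc m))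
move-view {c′ = c′} (split1 st) = by-split₁ (twice-δ≤-at removed≤c) (step-≗ st removed≤c)
  where removed≤c = step-removes-present {c′ = c′} st split₁-disjoint
move-view {c′ = c′} (split2 st) = by-split₂ (twice-δ≤-at removed≤c) (step-≗ st removed≤c)
  where removed≤c = step-removes-present {c′ = c′} st split₂-disjoint
move-view {c′ = c′} (splitHi i 3≤i st) = by-split i 3≤i (twice-δ≤-at removed≤c) (step-≗ st removed≤c)
  where removed≤c = step-removes-present {c′ = c′} st (split-disjoint 3≤i)

step-resp : ∀ {r a} → Step c c′ r a → c ≗ d → Step d c′ r a
step-resp {a = a} st c≗d j = trans (st j) (cong (_+ a j) (c≗d j))

-- Step unfolds to a Π-type, so the multisets of a Step argument are only inferred
-- once its two positions are given explicitly.
move-resp : Move c c′ → c ≗ d → Move d c′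
move-resp {c} {c′} {d} mv c≗d = moved mv
  where
    step-moved : ∀ {r a} → Step c c′ r a → Step d c′ r a
    step-moved st = step-resp {c = c} {c′ = c′} st c≗d
    moved : Move c c′ → Move d c′
    moved (combine m 1≤m st) = combine m 1≤m (step-moved st)
    moved (split1 st) = split1 (step-moved st)
    moved (split2 st) = split2 (step-moved st)
    moved (splitHi i 3≤i st) = splitHi i 3≤i (step-moved st)

zeck-resp : Zeck c → c ≗ d → Zeck d
zeck-resp (≤1 , adjacent≤1) c≗d =
  (λ j → subst (_≤ 1) (c≗d j) (≤1 j)) ,
  (λ j → subst (_≤ 1) (cong₂ _+_ (c≗d j) (c≗d (suc j))) (adjacent≤1 j))

win-resp : ∀ {p T} → Win p T c j → c ≗ d → Win p T d j
win-resp (ours ¬zeck t c′ mv next) c≗d =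
  ours (λ z → ¬zeck (zeck-resp z (sym ∘ c≗d))) t c′ (move-resp mv c≗d) next
win-resp (theirs ¬zeck ¬t replies) c≗d =
  theirs (λ z → ¬zeck (zeck-resp z (sym ∘ c≗d))) ¬t (λ c′ mv → replies c′ (move-resp mv (sym ∘ c≗d)))

win⇒¬zeck : ∀ {p T} → Win p T c j → ¬ Zeck c
win⇒¬zeck (ours ¬zeck _ _ _ _) = ¬zeck
win⇒¬zeck (theirs ¬zeck _ _) = ¬zeck

-- Index 0 stands for the unused F 0. Positions of the game never contain it,
-- and without this a non-Zeckendorf position need not admit a move.
Proper : Position → Set
Proper c = c 0 ≡ 0

step-proper : ∀ {r a} → Step c c′ r a → a 0 ≡ 0 → Proper c → Proper c′
step-proper {c′ = c′} st a0≡0 c0≡0 = m+n≡0⇒m≡0 (c′ 0) (trans (st 0) (cong₂ _+_ c0≡0 a0≡0))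

move-proper : Move c c′ → Proper c → Proper c′
move-proper {c} {c′} (combine m _ st) = step-proper {c = c} {c′ = c′} st refl
move-proper {c} {c′} (split1 st) = step-proper {c = c} {c′ = c′} st refl
move-proper {c} {c′} (split2 st) = step-proper {c = c} {c′ = c′} st refl
move-proper {c} {c′} (splitHi (suc (suc (suc i))) _ st) = step-proper {c = c} {c′ = c′} st refl
move-proper (splitHi (suc zero) (s≤s ()) _)
move-proper (splitHi (suc (suc zero)) (s≤s (s≤s ())) _)

double-move : Proper c → 2 ≤ c j → Σ Position (Move c)
double-move {j = zero} c0≡0 2≤c0 with () ← subst (2 ≤_) c0≡0 2≤c0
double-move {j = suc zero} _ 2≤c1 = _ , split₁-move 2≤c1
double-move {j = suc (suc zero)} _ 2≤c2 = _ , split₂-move 2≤c2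
double-move {j = suc (suc (suc j))} _ 2≤cj = _ , split-move (s≤s (s≤s (s≤s z≤n))) 2≤cj

adjacent-move : Proper c → 1 ≤ c j → 1 ≤ c (suc j) → Σ Position (Move c)
adjacent-move {j = zero} c0≡0 1≤c0 _ with () ← subst (1 ≤_) c0≡0 1≤c0
adjacent-move {j = suc j} _ 1≤cj 1≤cj+1 = _ , merge-move (s≤s z≤n) 1≤cj 1≤cj+1

bits-sum≤1 : ∀ {x y} → x ≤ 1 → y ≤ 1 → (1 ≤ x → 1 ≤ y → ⊥) → x + y ≤ 1
bits-sum≤1 z≤n y≤1 _ = y≤1
bits-sum≤1 (s≤s z≤n) z≤n _ = s≤s z≤n
bits-sum≤1 (s≤s z≤n) (s≤s z≤n) not-both = ⊥-elim (not-both (s≤s z≤n) (s≤s z≤n))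

stuck⇒zeck : Proper c → ¬ Σ Position (Move c) → Zeck c
stuck⇒zeck {c} proper stuck = at-most-one , no-adjacent
  where
    at-most-one : ∀ j → c j ≤ 1
    at-most-one j with c j ≤? 1
    ... | yes cj≤1 = cj≤1
    ... | no cj≰1 = ⊥-elim (stuck (double-move proper (≰⇒> cj≰1)))
    no-adjacent : ∀ j → c j + c (suc j) ≤ 1
    no-adjacent j = bits-sum≤1 (at-most-one j) (at-most-one (suc j))
      (λ 1≤cj 1≤cj+1 → stuck (adjacent-move proper 1≤cj 1≤cj+1))

step-ones : ∀ {r a} → Step c c′ r a → r 1 ≤ 2 → c 1 ≤ 2 + c′ 1
step-ones {c} {c′} {r} {a} st r1≤2 = begin
  c 1         ≤⟨ m≤m+n (c 1) (a 1) ⟩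
  c 1 + a 1   ≡⟨ sym (st 1) ⟩
  c′ 1 + r 1  ≤⟨ +-monoʳ-≤ (c′ 1) r1≤2 ⟩
  c′ 1 + 2    ≡⟨ +-comm (c′ 1) 2 ⟩
  2 + c′ 1    ∎
  where open ≤-Reasoning

move-ones : Move c c′ → c 1 ≤ 2 + c′ 1
move-ones {c} {c′} (combine m _ st) = step-ones {c = c} {c′ = c′} st (+-mono-≤ (δ≤1 m 1) (δ≤1 (suc m) 1))
move-ones {c} {c′} (split1 st) = step-ones {c = c} {c′ = c′} st ≤-refl
move-ones {c} {c′} (split2 st) = step-ones {c = c} {c′ = c′} st z≤n
move-ones {c} {c′} (splitHi i _ st) = step-ones {c = c} {c′ = c′} st (*-monoʳ-≤ 2 (δ≤1 i 1))

2≤ones⇒¬zeck : 2 ≤ c 1 → ¬ Zeck c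
2≤ones⇒¬zeck 2≤c1 (≤1 , _) = <-irrefl refl (≤-trans 2≤c1 (≤1 1))

ones : ℕ → Position
ones n zero = 0
ones n (suc zero) = n
ones n (suc (suc j)) = 0

_⊕_ : Position → ℕ → Position
(c ⊕ i) j = δ i j + c j

start≗ones : start n ≗ ones n
start≗ones {n} zero = *-zeroʳ n
start≗ones {n} (suc zero) = *-identityʳ n
start≗ones {n} (suc (suc j)) = *-zeroʳ n

infixr 5 _∷_

data Path : ℕ → Position → Position → Set where
  [] : Path 0 c c
  _∷_ : Move c d → Path m d e → Path (suc m) c e

path-proper : Path m c d → Proper c → Proper d
path-proper [] = λ proper → proper
path-proper (mv ∷ π) = path-proper π ∘ move-proper mv

path-ones : Path m c d → c 1 ≤ m * 2 + d 1
path-ones [] = ≤-refl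
path-ones (mv ∷ π) = ≤-trans (move-ones mv) (+-monoʳ-≤ 2 (path-ones π))

fuse₂ fuse₃ : Position → Position
fuse₂ c = merge 1 (split₁ c)
fuse₃ c = split₂ (split₁ (split₁ c))

split₁-cong : c ≗ d → split₁ c ≗ split₁ d
split₁-cong = ↦-cong {r = λ j → 2 * δ 1 j} {a = δ 2}

merge-cong : ∀ m → c ≗ d → merge m c ≗ merge m d
merge-cong m = ↦-cong {r = λ j → δ m j + δ (suc m) j} {a = δ (suc (suc m))}

fuse₂-cong : c ≗ d → fuse₂ c ≗ fuse₂ d
fuse₂-cong = merge-cong 1 ∘ split₁-cong

fuse₂≗fuse₃ : 4 ≤ c 1 → fuse₂ c ≗ fuse₃ c
fuse₂≗fuse₃ _ zero = refl
fuse₂≗fuse₃ 4≤c1 (suc zero) with _ , c1≡4+w ← m≤n⇒∃[o]m+o≡n 4≤c1 rewrite sym c1≡4+w = refl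
fuse₂≗fuse₃ _ (suc (suc zero)) = refl
fuse₂≗fuse₃ _ (suc (suc (suc zero))) = refl
fuse₂≗fuse₃ _ (suc (suc (suc (suc j)))) = refl

fuse₂-ones : 3 ≤ c 1 → c 1 ≡ 3 + fuse₂ c 1
fuse₂-ones {c} 3≤c1 = sym (begin
  3 + ((c 1 ∸ 2) ∸ 1)   ≡⟨ +-comm 3 _ ⟩
  (c 1 ∸ 2) ∸ 1 + 3     ≡⟨ cong (_+ 3) (∸-+-assoc (c 1) 2 1) ⟩
  c 1 ∸ 3 + 3           ≡⟨ m∸n+n≡m 3≤c1 ⟩
  c 1                   ∎)
  where open ≡-Reasoning

fuse₃-ones : 4 ≤ c 1 → c 1 ≡ 3 + fuse₃ c 1
fuse₃-ones {c} 4≤c1 = sym (begin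
  4 + ((c 1 ∸ 2) ∸ 2)   ≡⟨ +-comm 4 _ ⟩
  (c 1 ∸ 2) ∸ 2 + 4     ≡⟨ cong (_+ 4) (∸-+-assoc (c 1) 2 2) ⟩
  c 1 ∸ 4 + 4           ≡⟨ m∸n+n≡m 4≤c1 ⟩
  c 1                   ∎)
  where open ≡-Reasoning

fuse₂-path : ∀ m → m * 3 ≤ c 1 → Path (m * 2) c (iterate fuse₂ c m)
fuse₂-path zero _ = []
fuse₂-path {c} (suc m) enough =
  split₁-move (≤-trans (s≤s (s≤s z≤n)) 3≤c1) ∷ merge-move ≤-refl (m+n≤o⇒m≤o∸n 1 3≤c1) (s≤s z≤n) ∷
  fuse₂-path m (+-cancelˡ-≤ 3 _ _ (≤-trans enough (≤-reflexive (fuse₂-ones {c} 3≤c1))))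
  where
    3≤c1 : 3 ≤ c 1
    3≤c1 = ≤-trans (m≤m+n 3 (m * 3)) enough

fuse₃-path : ∀ m → m * 3 + 1 ≤ c 1 → Path (m * 3) c (iterate fuse₃ c m)
fuse₃-path zero _ = []
fuse₃-path {c} (suc m) enough =
  split₁-move (≤-trans (s≤s (s≤s z≤n)) 4≤c1) ∷ split₁-move (m+n≤o⇒m≤o∸n 2 4≤c1) ∷ split₂-move (s≤s (s≤s z≤n)) ∷
  fuse₃-path m (+-cancelˡ-≤ 3 _ _ (≤-trans enough (≤-reflexive (fuse₃-ones {c} 4≤c1))))
  where
    4≤c1 : 4 ≤ c 1
    4≤c1 = ≤-trans (+-monoʳ-≤ 3 (m≤n+m 1 (m * 3))) enough

iterate-≗ : ∀ {f : Position → Position} → (∀ {c d} → c ≗ d → f c ≗ f d) →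
            c ≗ d → ∀ m → iterate f c m ≗ iterate f d m
iterate-≗ f-cong c≗d zero = c≗d
iterate-≗ f-cong c≗d (suc m) = iterate-≗ f-cong (f-cong c≗d) m

iterate-fuse₂≗fuse₃ : ∀ m → m * 3 + 1 ≤ c 1 → iterate fuse₂ c m ≗ iterate fuse₃ c m
iterate-fuse₂≗fuse₃ zero _ = λ _ → refl
iterate-fuse₂≗fuse₃ {c} (suc m) enough j = trans
  (iterate-≗ fuse₂-cong (fuse₂≗fuse₃ 4≤c1) m j)
  (iterate-fuse₂≗fuse₃ m (+-cancelˡ-≤ 3 _ _ (≤-trans enough (≤-reflexive (fuse₃-ones {c} 4≤c1)))) j)
  where
    4≤c1 : 4 ≤ c 1
    4≤c1 = ≤-trans (+-monoʳ-≤ 3 (m≤n+m 1 (m * 3))) enough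

frugal-move : c 2 ≤ 2 → 3 ≤ c 1 + c 2 → Σ Position λ d → Move c d × d 2 ≤ 2 × c 1 + c 2 ≡ suc (d 1 + d 2)
frugal-move {c} c2≤2 3≤c1+c2 with 2 ≤? c 2
... | yes 2≤c2 = split₂ c , split₂-move 2≤c2 , ≤-trans (m∸n≤m (c 2) 2) c2≤2 , count
  where
    count : c 1 + c 2 ≡ suc (suc (c 1) + (c 2 ∸ 2))
    count = begin
      c 1 + c 2                     ≡⟨ cong (c 1 +_) (sym (m+[n∸m]≡n 2≤c2)) ⟩
      c 1 + (2 + (c 2 ∸ 2))         ≡⟨ +-suc (c 1) _ ⟩
      suc (c 1 + (1 + (c 2 ∸ 2)))   ≡⟨ cong suc (+-suc (c 1) _) ⟩
      suc (suc (c 1) + (c 2 ∸ 2))   ∎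
      where open ≡-Reasoning
... | no 2≰c2 = split₁ c , split₁-move 2≤c1 , s≤s c2≤1 , count
  where
    c2≤1 : c 2 ≤ 1
    c2≤1 = ≤-pred (≰⇒> 2≰c2)
    2≤c1 : 2 ≤ c 1
    2≤c1 = +-cancelʳ-≤ 1 2 (c 1) (≤-trans (≤-reflexive (+-comm 2 1)) (≤-trans 3≤c1+c2 (+-monoʳ-≤ (c 1) c2≤1)))
    count : c 1 + c 2 ≡ suc ((c 1 ∸ 2) + suc (c 2))
    count = begin
      c 1 + c 2                     ≡⟨ cong (_+ c 2) (sym (m+[n∸m]≡n 2≤c1)) ⟩
      2 + (c 1 ∸ 2) + c 2           ≡⟨ cong suc (sym (+-suc (c 1 ∸ 2) (c 2))) ⟩
      suc ((c 1 ∸ 2) + suc (c 2))   ∎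
      where open ≡-Reasoning

frugal-path : ∀ m → c 2 ≤ 2 → m + 2 ≤ c 1 + c 2 →
              Σ Position λ d → Path m c d × d 2 ≤ 2 × c 1 + c 2 ≡ m + (d 1 + d 2)
frugal-path zero c2≤2 _ = _ , [] , c2≤2 , refl
frugal-path (suc m) c2≤2 enough with frugal-move c2≤2 (≤-trans (s≤s (m≤n+m 2 m)) enough)
... | c′ , mv , c′2≤2 , count with frugal-path m c′2≤2 (≤-pred (≤-trans enough (≤-reflexive count)))
... | d , π , d2≤2 , count′ = d , mv ∷ π , d2≤2 , trans count (cong suc count′)

-- Turn order

next-suc : suc j < p → next p j ≡ suc j
next-suc {j} {p} j+1<p with suc j ≡ᵇ p in eq
... | true = ⊥-elim (<-irrefl (≡ᵇ⇒≡ (suc j) p (subst Bool.T (sym eq) _)) j+1<p)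
... | false = refl

next-wrap : suc j ≡ p → next p j ≡ 0
next-wrap {j} {p} j+1≡p with suc j ≡ᵇ p in eq
... | true = refl
... | false = ⊥-elim (subst Bool.T eq (≡⇒≡ᵇ (suc j) p j+1≡p))

next-< : j < p → next p j < p
next-< j<p with m≤n⇒m<n∨m≡n j<p
... | inj₁ j+1<p = subst (_< _) (sym (next-suc j+1<p)) j+1<p
... | inj₂ j+1≡p = subst (_< _) (sym (next-wrap j+1≡p)) (≤-trans (s≤s z≤n) j<p)

iterate-< : j < p → ∀ m → iterate (next p) j m < p
iterate-< j<p zero = j<p
iterate-< j<p (suc m) = iterate-< (next-< j<p) m

iterate-+ : ∀ {A : Set} (f : A → A) x m {n} → iterate f x (m + n) ≡ iterate f (iterate f x m) n
iterate-+ f x zero = refl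
iterate-+ f x (suc m) = iterate-+ f (f x) m

iterate-comm : ∀ {A : Set} (f : A → A) x m → iterate f (f x) m ≡ f (iterate f x m)
iterate-comm f x zero = refl
iterate-comm f x (suc m) = iterate-comm f (f x) m

Offset : ℕ → ℕ → ℕ → ℕ → Set
Offset p a j ρ = j < p × ρ < p × (j ≡ a + ρ ⊎ j + p ≡ a + ρ)

offset-unique : ∀ {ρ′} → Offset p a j ρ → Offset p a j ρ′ → ρ ≡ ρ′
offset-unique {p} {a} {ρ = ρ} {ρ′} (_ , ρ<p , h) (_ , ρ′<p , h′) with h | h′
... | inj₁ e | inj₁ e′ = +-cancelˡ-≡ a ρ ρ′ (trans (sym e) e′)
... | inj₂ e | inj₂ e′ = +-cancelˡ-≡ a ρ ρ′ (trans (sym e) e′)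
... | inj₁ e | inj₂ e′ = ⊥-elim (<-irrefl ρ′≡ρ+p (<-≤-trans ρ′<p (m≤n+m p ρ)))
  where ρ′≡ρ+p = +-cancelˡ-≡ a ρ′ (ρ + p) (trans (sym e′) (trans (cong (_+ p) e) (+-assoc a ρ p)))
... | inj₂ e | inj₁ e′ = ⊥-elim (<-irrefl ρ≡ρ′+p (<-≤-trans ρ<p (m≤n+m p ρ′)))
  where ρ≡ρ′+p = +-cancelˡ-≡ a ρ (ρ′ + p) (trans (sym e) (trans (cong (_+ p) e′) (+-assoc a ρ′ p)))

offset-suc : a < p → Offset p a j ρ → suc ρ < p → Offset p a (next p j) (suc ρ)
offset-suc {a} {p} {j} {ρ} a<p (j<p , _ , h) ρ+1<p with m≤n⇒m<n∨m≡n j<p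
... | inj₁ j+1<p rewrite next-suc j+1<p = j+1<p , ρ+1<p , ⊎-map shift shift h
  where
    shift : ∀ {x} → x ≡ a + ρ → suc x ≡ a + suc ρ
    shift x≡a+ρ = trans (cong suc x≡a+ρ) (sym (+-suc a ρ))
... | inj₂ j+1≡p rewrite next-wrap j+1≡p = ≤-trans (s≤s z≤n) j<p , ρ+1<p , inj₂ (wrapped h)
  where
    wrapped : j ≡ a + ρ ⊎ j + p ≡ a + ρ → p ≡ a + suc ρ
    wrapped (inj₁ j≡a+ρ) = trans (sym j+1≡p) (trans (cong suc j≡a+ρ) (sym (+-suc a ρ)))
    wrapped (inj₂ j+p≡a+ρ) = ⊥-elim (<-irrefl a+ρ+1≡p+p (+-mono-< a<p ρ+1<p))
      where
        a+ρ+1≡p+p : a + suc ρ ≡ p + p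
        a+ρ+1≡p+p = trans (+-suc a ρ) (trans (cong suc (sym j+p≡a+ρ)) (cong (_+ p) j+1≡p))

offset-wrap : a < p → Offset p a j ρ → suc ρ ≡ p → Offset p a (next p j) 0
offset-wrap {a} {j = j} {ρ} a<p (j<p , _ , h) refl with m≤n⇒m<n∨m≡n j<p
... | inj₁ j+1<p rewrite next-suc j+1<p = j+1<p , z<s , inj₁ (wrapped h)
  where
    wrapped : j ≡ a + ρ ⊎ j + suc ρ ≡ a + ρ → suc j ≡ a + 0
    wrapped (inj₁ j≡a+ρ) =
      ⊥-elim (<-irrefl refl (<-≤-trans (≤-pred j+1<p) (≤-trans (m≤n+m ρ a) (≤-reflexive (sym j≡a+ρ)))))
    wrapped (inj₂ e) = trans (+-cancelʳ-≡ ρ (suc j) a (trans (sym (+-suc j ρ)) e)) (sym (+-identityʳ a))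
... | inj₂ j+1≡p rewrite next-wrap j+1≡p = z<s , z<s , inj₁ (sym (trans (+-identityʳ a) (a≡0 h)))
  where
    j≡ρ : j ≡ ρ
    j≡ρ = suc-injective j+1≡p
    a≡0 : j ≡ a + ρ ⊎ j + suc ρ ≡ a + ρ → a ≡ 0
    a≡0 (inj₁ e) = +-cancelʳ-≡ ρ a 0 (trans (sym e) j≡ρ)
    a≡0 (inj₂ e) = ⊥-elim (<-irrefl (sym ρ+1≡a) a<p)
      where
        ρ+1≡a : suc ρ ≡ a
        ρ+1≡a = +-cancelˡ-≡ ρ (suc ρ) a (trans (cong (_+ suc ρ) (sym j≡ρ)) (trans e (+-comm a ρ)))

offset-iterate : a < p → Offset p a j ρ → ρ + m < p → Offset p a (iterate (next p) j m) (ρ + m)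
offset-iterate {ρ = ρ} {zero} _ o _ = subst (Offset _ _ _) (sym (+-identityʳ ρ)) o
offset-iterate {p = p} {ρ = ρ} {suc m} a<p o ρ+m+1<p =
  subst (Offset _ _ _) (sym (+-suc ρ m)) (offset-iterate a<p (offset-suc a<p o ρ+1<p) ρ+1+m<p)
  where
    ρ+1+m<p : suc ρ + m < p
    ρ+1+m<p = subst (_< p) (+-suc ρ m) ρ+m+1<p
    ρ+1<p : suc ρ < p
    ρ+1<p = ≤-<-trans (m≤m+n (suc ρ) m) ρ+1+m<p

offset-iterate-wrap : a < p → Offset p a j ρ → ρ + m ≡ p → Offset p a (iterate (next p) j m) 0
offset-iterate-wrap {ρ = ρ} {zero} _ (_ , ρ<p , _) ρ+0≡p =
  ⊥-elim (<-irrefl (trans (sym (+-identityʳ ρ)) ρ+0≡p) ρ<p)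
offset-iterate-wrap {p = p} {j = j} {ρ} {suc m} a<p o ρ+m+1≡p =
  subst (λ x → Offset _ _ x 0) (sym (iterate-comm (next p) j m))
    (offset-wrap a<p (offset-iterate a<p o (subst (ρ + m <_) ρ+m+1≡p ρ+m<ρ+m+1))
                     (trans (sym (+-suc ρ m)) ρ+m+1≡p))
  where
    ρ+m<ρ+m+1 : ρ + m < ρ + suc m
    ρ+m<ρ+m+1 = ≤-reflexive (sym (+-suc ρ m))

offset-of-zero : a < p → Σ ℕ (Offset p a 0)
offset-of-zero {zero} 0<p = 0 , 0<p , 0<p , inj₁ refl
offset-of-zero {suc a} {suc p} (s≤s a<p) =
  p ∸ a , z<s , s≤s (m∸n≤m p a) , inj₂ (sym (cong suc (m+[n∸m]≡n (<⇒≤ a<p))))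

module Play (p : ℕ) (T : ℕ → Set) where

  Allies Outsiders : ℕ → ℕ → Set
  Allies m j = ∀ i → i < m → T (iterate (next p) j i)
  Outsiders m j = ∀ i → i < m → ¬ T (iterate (next p) j i)

  outsiders-path : Outsiders m j → Path m c d → Win p T c j → Win p T d (iterate (next p) j m)
  outsiders-path _ [] w = w
  outsiders-path outsiders (_ ∷ _) (ours _ t _ _ _) = ⊥-elim (outsiders 0 z<s t)
  outsiders-path outsiders (mv ∷ π) (theirs _ _ replies) =
    outsiders-path (λ i i<m → outsiders (suc i) (s≤s i<m)) π (replies _ mv)

  ally-move : T j → Win p T c j → 4 ≤ c 1 → Σ Position λ d → Move c d × Win p T d (next p j)
  ally-move t (theirs _ ¬t _) _ = ⊥-elim (¬t t)
  ally-move _ (ours _ _ d mv (inj₁ zeck)) 4≤c1 =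
    ⊥-elim (2≤ones⇒¬zeck (+-cancelˡ-≤ 2 2 (d 1) (≤-trans 4≤c1 (move-ones mv))) zeck)
  ally-move _ (ours _ _ d mv (inj₂ w)) _ = d , mv , w

  allies-run : ∀ m → Allies m j → Win p T c j → suc m * 2 ≤ c 1 →
               Σ Position λ d → Path m c d × Win p T d (iterate (next p) j m)
  allies-run zero _ w _ = _ , [] , w
  allies-run (suc m) allies w enough with ally-move (allies 0 z<s) w (≤-trans (m≤m+n 4 (m * 2)) enough)
  ... | c′ , mv , w′ with allies-run m (λ i i<m → allies (suc i) (s≤s i<m)) w′
                            (+-cancelˡ-≤ 2 _ _ (≤-trans enough (move-ones mv)))
  ... | d , π , w″ = d , mv ∷ π , w″

  -- The two games are played in lockstep: whichever mover is in the team chooses the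
  -- move, and the opponent to move in the other game copies it.
  module Stealing (gap : ℕ) (separated : ∀ {j} → j < p → T j → ¬ T (iterate (next p) j gap)) where

    next-lockstep : j₂ ≡ iterate (next p) j₁ gap → next p j₂ ≡ iterate (next p) (next p j₁) gap
    next-lockstep {j₁ = j₁} j₂≡ = trans (cong (next p) j₂≡) (sym (iterate-comm (next p) j₁ gap))

    steal : Proper c → j₁ < p → j₂ ≡ iterate (next p) j₁ gap → Win p T c j₁ → Win p T c j₂ → ⊥
    steal _ j₁<p j₂≡ (ours _ t₁ _ _ _) (ours _ t₂ _ _ _) = separated j₁<p t₁ (subst T j₂≡ t₂)
    steal _ _ _ (ours _ _ c′ mv (inj₁ zeck)) (theirs _ _ replies) = win⇒¬zeck (replies c′ mv) zeck
    steal _ _ _ (theirs _ _ replies) (ours _ _ c′ mv (inj₁ zeck)) = win⇒¬zeck (replies c′ mv) zeck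
    steal proper j₁<p j₂≡ (ours _ _ c′ mv (inj₂ w₁)) (theirs _ _ replies) =
      steal (move-proper mv proper) (next-< j₁<p) (next-lockstep j₂≡) w₁ (replies c′ mv)
    steal proper j₁<p j₂≡ (theirs _ _ replies) (ours _ _ c′ mv (inj₂ w₂)) =
      steal (move-proper mv proper) (next-< j₁<p) (next-lockstep j₂≡) (replies c′ mv) w₂
    steal proper j₁<p j₂≡ (theirs ¬zeck _ replies₁) (theirs _ _ replies₂) =
      ¬zeck (stuck⇒zeck proper λ (c′ , mv) →
        steal (move-proper mv proper) (next-< j₁<p) (next-lockstep j₂≡) (replies₁ c′ mv) (replies₂ c′ mv))

    fork : Proper c → j < p → Outsiders (m + gap) j → Path m c d → Path (m + gap) c d′ → d ≗ d′ →
           Win p T c j → ⊥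
    fork {j = j} {m} proper j<p outsiders π π′ d≗d′ w =
      steal (path-proper π proper) (iterate-< j<p m) (iterate-+ (next p) j m)
        (outsiders-path (λ i i<m → outsiders i (≤-trans i<m (m≤m+n m gap))) π w)
        (win-resp (outsiders-path outsiders π′ w) (sym ∘ d≗d′))

module Team (p k : ℕ) (T : ℕ → Set) (team : ConsecBlock p k T) (0<k : 0 < k) (k+k≤p : k + k ≤ p) where

  open Play p T public

  first : ℕ
  first = proj₁ team

  first<p : first < p
  first<p = proj₁ (proj₂ team)

  k<p : k < p
  k<p = <-≤-trans (m<m+n k 0<k) k+k≤p

  member : Offset p first j ρ → ρ < k → T j
  member (j<p , _ , h) ρ<k = Equivalence.from (proj₂ (proj₂ team) _ j<p) (_ , ρ<k , h)

  member-offset : j < p → T j → Σ ℕ λ i → i < k × Offset p first j i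
  member-offset j<p t with Equivalence.to (proj₂ (proj₂ team) _ j<p) t
  ... | i , i<k , h = i , i<k , j<p , <-trans i<k k<p , h

  nonmember : Offset p first j ρ → k ≤ ρ → ¬ T j
  nonmember o k≤ρ t with member-offset (proj₁ o) t
  ... | i , i<k , o′ = <-irrefl (offset-unique o′ o) (<-≤-trans i<k k≤ρ)

  separated : j < p → T j → ¬ T (iterate (next p) j k)
  separated j<p t with member-offset j<p t
  ... | i , i<k , o = nonmember (offset-iterate first<p o (<-≤-trans (+-monoˡ-< k i<k) k+k≤p)) (m≤n+m k i)

  allies-from : Offset p first j ρ → ρ + m ≤ k → Allies m j
  allies-from {ρ = ρ} o ρ+m≤k i i<m = member (offset-iterate first<p o (<-trans ρ+i<k k<p)) ρ+i<k
    where
      ρ+i<k = <-≤-trans (+-monoʳ-< ρ i<m) ρ+m≤k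

  outsiders-from : Offset p first j ρ → k ≤ ρ → ρ + m ≤ p → Outsiders m j
  outsiders-from {ρ = ρ} o k≤ρ ρ+m≤p i i<m =
    nonmember (offset-iterate first<p o (<-≤-trans (+-monoʳ-< ρ i<m) ρ+m≤p)) (≤-trans k≤ρ (m≤m+n ρ i))

  allies-turn : Offset p first j ρ → ρ + m ≤ k → Win p T c j → suc m * 2 ≤ c 1 →
                Σ ℕ λ j′ → Σ Position λ d → Offset p first j′ (ρ + m) × Path m c d × Win p T d j′
  allies-turn o ρ+m≤k w enough with allies-run _ (allies-from o ρ+m≤k) w enough
  ... | d , π , w′ = _ , d , offset-iterate first<p o (≤-<-trans ρ+m≤k k<p) , π , w′

  outsiders-turn : Offset p first j ρ → k ≤ ρ → ρ + m ≡ p → Path m c d → Win p T c j →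
                   Σ ℕ λ j′ → Offset p first j′ 0 × Win p T d j′
  outsiders-turn o k≤ρ ρ+m≡p π w =
    _ , offset-iterate-wrap first<p o ρ+m≡p , outsiders-path (outsiders-from o k≤ρ (≤-reflexive ρ+m≡p)) π w

  open Stealing k separated public

module LargeTeam (p k : ℕ) (T : ℕ → Set) (team : ConsecBlock p k T) (0<k : 0 < k) (k*4≤p : k * 4 ≤ p) where

  k+k≤p : k + k ≤ p
  k+k≤p = ≤-trans (≤-trans (m≤m+n (k + k) (k + k)) (≤-reflexive (double k))) k*4≤p
    where
      double : ∀ k → (k + k) + (k + k) ≡ k * 4
      double = solve-∀

  open Team p k T team 0<k k+k≤p

  fork-at-k : Offset p first j k → Win p T c j → Proper c → k * 3 + 1 ≤ c 1 → ⊥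
  fork-at-k {c = c} o w proper enough =
    fork proper (proj₁ o) (outsiders-from o ≤-refl (≤-trans (≤-reflexive (k+[k*2+k]≡ k)) k*4≤p))
      (fuse₂-path k (≤-trans (m≤m+n (k * 3) 1) enough))
      (subst (λ m → Path m c (iterate fuse₃ c k)) (k*3≡ k) (fuse₃-path k enough))
      (iterate-fuse₂≗fuse₃ k enough) w
    where
      k+[k*2+k]≡ : ∀ k → k + (k * 2 + k) ≡ k * 4
      k+[k*2+k]≡ = solve-∀
      k*3≡ : ∀ k → k * 3 ≡ k * 2 + k
      k*3≡ = solve-∀

  allies-then-fork : Offset p first j ρ → ρ ≤ k → Win p T c j → Proper c → k * 2 + (k * 3 + 1) ≤ c 1 → ⊥
  allies-then-fork {ρ = ρ} {c = c} o ρ≤k w proper enough =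
    let j′ , d , o′ , π , w′ = allies-turn o (≤-reflexive (m+[n∸m]≡n ρ≤k)) w budget
    in fork-at-k (subst (Offset p first j′) (m+[n∸m]≡n ρ≤k) o′) w′ (path-proper π proper) (remaining π)
    where
      [k∸ρ]*2≤k*2 : (k ∸ ρ) * 2 ≤ k * 2
      [k∸ρ]*2≤k*2 = *-monoˡ-≤ 2 (m∸n≤m k ρ)
      2≤k*3+1 : 2 ≤ k * 3 + 1
      2≤k*3+1 = ≤-trans (s≤s (s≤s z≤n)) (≤-trans (*-monoˡ-≤ 3 0<k) (m≤m+n (k * 3) 1))
      budget : suc (k ∸ ρ) * 2 ≤ c 1
      budget = ≤-trans (≤-trans (≤-reflexive (+-comm 2 _)) (+-mono-≤ [k∸ρ]*2≤k*2 2≤k*3+1)) enough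
      remaining : ∀ {d : Position} → Path (k ∸ ρ) c d → k * 3 + 1 ≤ d 1
      remaining π = +-cancelˡ-≤ ((k ∸ ρ) * 2) _ _
        (≤-trans (+-monoˡ-≤ _ [k∸ρ]*2≤k*2) (≤-trans enough (path-ones π)))

  outsiders-then-allies : Offset p first j ρ → k < ρ → Win p T c j → Proper c → c 2 ≤ 2 →
                          (p ∸ ρ) + (k * 2 + (k * 3 + 1) + 2) ≤ c 1 + c 2 → ⊥
  outsiders-then-allies {ρ = ρ} {c = c} o k<ρ w proper c2≤2 enough =
    let d , π , d2≤2 , count = frugal-path {c = c} (p ∸ ρ) c2≤2 (≤-trans (+-monoʳ-≤ (p ∸ ρ) (m≤n+m 2 _)) enough)
        j′ , o′ , w′ = outsiders-turn o (<⇒≤ k<ρ) (m+[n∸m]≡n (<⇒≤ (proj₁ (proj₂ o)))) π w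
    in allies-then-fork o′ z≤n w′ (path-proper π proper) (remaining {d} count d2≤2)
    where
      remaining : ∀ {d : Position} → c 1 + c 2 ≡ (p ∸ ρ) + (d 1 + d 2) → d 2 ≤ 2 → k * 2 + (k * 3 + 1) ≤ d 1
      remaining {d} count d2≤2 = +-cancelʳ-≤ 2 _ _
        (≤-trans (+-cancelˡ-≤ (p ∸ ρ) _ _ (≤-trans enough (≤-reflexive count))) (+-monoʳ-≤ (d 1) d2≤2))

  allies-first-budget : k * 4 + 2 + p ≤ n → k * 2 + (k * 3 + 1) ≤ n
  allies-first-budget n-large with q , k+q≡p ← m≤n⇒∃[o]m+o≡n (<⇒≤ k<p) =
    ≤-trans (m≤m+n _ (suc q))
      (≤-trans (≤-reflexive (trans (reshuffle k q) (cong (k * 4 + 2 +_) k+q≡p))) n-large)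
    where
      reshuffle : ∀ k q → k * 2 + (k * 3 + 1) + suc q ≡ k * 4 + 2 + (k + q)
      reshuffle = solve-∀

  outsiders-first-budget : k * 4 + 2 + p ≤ n → k < ρ → ρ < p → (p ∸ ρ) + (k * 2 + (k * 3 + 1) + 2) ≤ n + 0
  outsiders-first-budget {n} {ρ} n-large k<ρ ρ<p with r , k+1+r≡ρ ← m≤n⇒∃[o]m+o≡n k<ρ =
    ≤-trans (m≤m+n _ r)
      (≤-trans (≤-reflexive (trans (reshuffle k r (p ∸ ρ)) (cong (k * 4 + 2 +_) k+1+r+[p∸ρ]≡p)))
        (≤-trans n-large (≤-reflexive (sym (+-identityʳ n)))))
    where
      k+1+r+[p∸ρ]≡p : suc k + r + (p ∸ ρ) ≡ p
      k+1+r+[p∸ρ]≡p = trans (cong (_+ (p ∸ ρ)) k+1+r≡ρ) (m+[n∸m]≡n (<⇒≤ ρ<p))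
      reshuffle : ∀ k r s → s + (k * 2 + (k * 3 + 1) + 2) + r ≡ k * 4 + 2 + (suc k + r + s)
      reshuffle = solve-∀

  no-winning-strategy : k * 4 + 2 + p ≤ n → ¬ Win p T (ones n) 0
  no-winning-strategy n-large w with offset-of-zero first<p
  ... | ρ , o with ρ ≤? k
  ... | yes ρ≤k = allies-then-fork o ρ≤k w refl (allies-first-budget n-large)
  ... | no ρ≰k =
    outsiders-then-allies o (≰⇒> ρ≰k) w refl z≤n (outsiders-first-budget n-large (≰⇒> ρ≰k) (proj₁ (proj₂ o)))

module ThreeTeams (T : ℕ → Set) (team : ConsecBlock 6 2 T) where

  open Team 6 2 T team z<s (s≤s (s≤s (s≤s (s≤s z≤n))))

  Forkable : Position → Set
  Forkable c = 1 ≤ c 3 ⊎ 2 ≤ c 2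

  fork₂ : Offset 6 first j 2 → Win 6 T c j → Proper c → 4 ≤ c 1 → Forkable c → ⊥
  fork₂ {c = c} o w proper 4≤c1 (inj₁ 1≤c3) =
    fork {m = 2} proper (proj₁ o) (outsiders-from o ≤-refl ≤-refl) short long short≗long w
    where
      short : Path 2 c (merge 2 (split₁ c))
      short = split₁-move (≤-trans (s≤s (s≤s z≤n)) 4≤c1) ∷ merge-move (s≤s z≤n) (s≤s z≤n) 1≤c3 ∷ []
      long : Path 4 c (split 3 (split₂ (split₁ (split₁ c))))
      long = split₁-move (≤-trans (s≤s (s≤s z≤n)) 4≤c1) ∷ split₁-move (m+n≤o⇒m≤o∸n 2 4≤c1) ∷
             split₂-move (s≤s (s≤s z≤n)) ∷ split-move ≤-refl (s≤s 1≤c3) ∷ []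
      short≗long : merge 2 (split₁ c) ≗ split 3 (split₂ (split₁ (split₁ c)))
      short≗long zero = refl
      short≗long (suc zero) with _ , c1≡4+x ← m≤n⇒∃[o]m+o≡n 4≤c1 rewrite sym c1≡4+x = refl
      short≗long (suc (suc zero)) = refl
      short≗long (suc (suc (suc zero))) = refl
      short≗long (suc (suc (suc (suc zero)))) = refl
      short≗long (suc (suc (suc (suc (suc j))))) = refl
  fork₂ {c = c} o w proper 4≤c1 (inj₂ 2≤c2) =
    fork {m = 2} proper (proj₁ o) (outsiders-from o ≤-refl ≤-refl) short long short≗long w
    where
      short : Path 2 c (merge 1 (merge 1 c))
      short = merge-move ≤-refl (≤-trans (s≤s z≤n) 4≤c1) (≤-trans (s≤s z≤n) 2≤c2) ∷
              merge-move ≤-refl (m+n≤o⇒m≤o∸n 1 (≤-trans (s≤s (s≤s z≤n)) 4≤c1)) (m+n≤o⇒m≤o∸n 1 2≤c2) ∷ []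
      long : Path 4 c (split₂ (split₁ (split₁ (split₂ c))))
      long = split₂-move 2≤c2 ∷ split₁-move (s≤s (≤-trans (s≤s z≤n) 4≤c1)) ∷
             split₁-move (m+n≤o⇒m≤o∸n 2 (≤-trans (s≤s (s≤s (s≤s z≤n))) 4≤c1)) ∷ split₂-move (s≤s (s≤s z≤n)) ∷ []
      short≗long : merge 1 (merge 1 c) ≗ split₂ (split₁ (split₁ (split₂ c)))
      short≗long zero = refl
      short≗long (suc zero) with _ , c1≡4+x ← m≤n⇒∃[o]m+o≡n 4≤c1 rewrite sym c1≡4+x = refl
      short≗long (suc (suc zero)) with _ , c2≡2+x ← m≤n⇒∃[o]m+o≡n 2≤c2 rewrite sym c2≡2+x = refl
      short≗long (suc (suc (suc zero))) = refl
      short≗long (suc (suc (suc (suc j)))) = refl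

  Quiet : Position → Set
  Quiet c = ∀ j → c (4 + j) ≤ 1 × c (4 + j) + c (5 + j) ≤ 1

  quiet-ones⊕ : ∀ u i → Quiet (ones u ⊕ i)
  quiet-ones⊕ u i j =
    ≤-trans (≤-reflexive (+-identityʳ (δ i (4 + j)))) (δ≤1 i (4 + j)) ,
    ≤-trans (≤-reflexive (cong₂ _+_ (+-identityʳ (δ i (4 + j))) (+-identityʳ (δ i (5 + j)))))
            (δ-adjacent i (4 + j))

  data QuietMove (c c′ : Position) : Set where
    by-merge₁ : 1 ≤ c 2 → c′ ≗ merge 1 c → QuietMove c c′
    by-merge₂ : 1 ≤ c 2 → 1 ≤ c 3 → c′ ≗ merge 2 c → QuietMove c c′
    by-merge₃ : 1 ≤ c 3 → 1 ≤ c 4 → c′ ≗ merge 3 c → QuietMove c c′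
    by-split₁ : c′ ≗ split₁ c → QuietMove c c′
    by-split₂ : 2 ≤ c 2 → c′ ≗ split₂ c → QuietMove c c′
    by-split₃ : 2 ≤ c 3 → c′ ≗ split 3 c → QuietMove c c′

  quiet-view : Quiet c → Move c c′ → QuietMove c c′
  quiet-view quiet mv with move-view mv
  ... | by-merge 1 _ _ 1≤c2 c′≗ = by-merge₁ 1≤c2 c′≗
  ... | by-merge 2 _ 1≤c2 1≤c3 c′≗ = by-merge₂ 1≤c2 1≤c3 c′≗
  ... | by-merge 3 _ 1≤c3 1≤c4 c′≗ = by-merge₃ 1≤c3 1≤c4 c′≗
  ... | by-merge (suc (suc (suc (suc j)))) _ 1≤cj 1≤cj+1 _ =
    ⊥-elim (<-irrefl refl (≤-trans (+-mono-≤ 1≤cj 1≤cj+1) (proj₂ (quiet j))))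
  ... | by-split₁ _ c′≗ = by-split₁ c′≗
  ... | by-split₂ 2≤c2 c′≗ = by-split₂ 2≤c2 c′≗
  ... | by-split 3 _ 2≤c3 c′≗ = by-split₃ 2≤c3 c′≗
  ... | by-split 1 (s≤s ()) _ _
  ... | by-split 2 (s≤s (s≤s ())) _ _
  ... | by-split (suc (suc (suc (suc j)))) _ 2≤cj _ = ⊥-elim (<-irrefl refl (≤-trans 2≤cj (proj₁ (quiet j))))

  forced-split₁ : Quiet c → c 2 ≡ 0 → c 3 ≤ 1 → c 3 ≡ 0 ⊎ c 4 ≡ 0 → Move c d → d ≗ split₁ c
  forced-split₁ quiet c2≡0 c3≤1 c3c4≡0 mv with quiet-view quiet mv
  ... | by-split₁ d≗ = d≗
  ... | by-merge₁ 1≤c2 _ = ⊥-elim (≤⇒≯ (≤-reflexive c2≡0) 1≤c2)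
  ... | by-merge₂ 1≤c2 _ _ = ⊥-elim (≤⇒≯ (≤-reflexive c2≡0) 1≤c2)
  ... | by-split₂ 2≤c2 _ = ⊥-elim (≤⇒≯ (≤-trans (≤-reflexive c2≡0) z≤n) 2≤c2)
  ... | by-split₃ 2≤c3 _ = ⊥-elim (≤⇒≯ c3≤1 2≤c3)
  ... | by-merge₃ 1≤c3 1≤c4 _ with c3c4≡0
  ...   | inj₁ c3≡0 = ⊥-elim (≤⇒≯ (≤-reflexive c3≡0) 1≤c3)
  ...   | inj₂ c4≡0 = ⊥-elim (≤⇒≯ (≤-reflexive c4≡0) 1≤c4)

  forkable-after : Quiet c → 1 ≤ c 2 → c 3 ≡ 0 → Move c d → Forkable d
  forkable-after quiet 1≤c2 c3≡0 mv with quiet-view quiet mv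
  ... | by-merge₁ _ d≗ = inj₁ (subst (1 ≤_) (sym (d≗ 3)) (s≤s z≤n))
  ... | by-split₁ d≗ = inj₂ (subst (2 ≤_) (sym (d≗ 2)) (s≤s 1≤c2))
  ... | by-split₂ _ d≗ = inj₁ (subst (1 ≤_) (sym (d≗ 3)) (s≤s z≤n))
  ... | by-merge₂ _ 1≤c3 _ = ⊥-elim (≤⇒≯ (≤-reflexive c3≡0) 1≤c3)
  ... | by-merge₃ 1≤c3 _ _ = ⊥-elim (≤⇒≯ (≤-reflexive c3≡0) 1≤c3)
  ... | by-split₃ 2≤c3 _ = ⊥-elim (≤⇒≯ (≤-trans (≤-reflexive c3≡0) z≤n) 2≤c3)

  forkable-after-two₀ : Quiet c → c 2 ≡ 0 → c 3 ≡ 0 → Path 2 c d → Forkable d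
  forkable-after-two₀ quiet c2≡0 c3≡0 (mv₁ ∷ mv₂ ∷ []) =
    forkable-after quiet (s≤s z≤n) c3≡0
      (move-resp mv₂ (forced-split₁ quiet c2≡0 (≤-trans (≤-reflexive c3≡0) z≤n) (inj₁ c3≡0) mv₁))

  forkable-after-two₁ : Quiet c → c 2 ≡ 1 → c 3 ≡ 0 → c 4 ≡ 0 → Path 2 c d → Forkable d
  forkable-after-two₁ {c} quiet c2≡1 c3≡0 c4≡0 (mv₁ ∷ mv₂ ∷ []) with quiet-view quiet mv₁
  ... | by-merge₁ _ c′≗ = inj₁ (subst (1 ≤_) (sym (d≗ 3)) (s≤s z≤n))
    where
      d≗ = forced-split₁ {merge 1 c} quiet (cong (_∸ 1) c2≡1) (≤-reflexive (cong suc c3≡0)) (inj₂ c4≡0)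
             (move-resp mv₂ c′≗)
  ... | by-split₁ c′≗ = forkable-after quiet (s≤s z≤n) c3≡0 (move-resp mv₂ c′≗)
  ... | by-merge₂ _ 1≤c3 _ = ⊥-elim (≤⇒≯ (≤-reflexive c3≡0) 1≤c3)
  ... | by-merge₃ 1≤c3 _ _ = ⊥-elim (≤⇒≯ (≤-reflexive c3≡0) 1≤c3)
  ... | by-split₂ 2≤c2 _ = ⊥-elim (≤⇒≯ (≤-reflexive c2≡1) 2≤c2)
  ... | by-split₃ 2≤c3 _ = ⊥-elim (≤⇒≯ (≤-trans (≤-reflexive c3≡0) z≤n) 2≤c3)

  forkable-after-two₃ : Quiet c → c 2 ≡ 0 → c 3 ≡ 1 → c 4 ≡ 0 → Path 2 c d → Forkable d ⊎ d ≗ merge 2 (split₁ c)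
  forkable-after-two₃ {c} quiet c2≡0 c3≡1 c4≡0 (mv₁ ∷ mv₂ ∷ [])
    with quiet-view {split₁ c} quiet
           (move-resp mv₂ (forced-split₁ quiet c2≡0 (≤-reflexive c3≡1) (inj₂ c4≡0) mv₁))
  ... | by-merge₁ _ d≗ = inj₁ (inj₁ (subst (1 ≤_) (sym (d≗ 3)) (s≤s z≤n)))
  ... | by-merge₂ _ _ d≗ = inj₂ d≗
  ... | by-split₁ d≗ = inj₁ (inj₁ (subst (1 ≤_) (sym (trans (d≗ 3) c3≡1)) (s≤s z≤n)))
  ... | by-merge₃ _ 1≤c4 _ = ⊥-elim (≤⇒≯ (≤-reflexive c4≡0) 1≤c4)
  ... | by-split₂ 2≤c2+1 _ = ⊥-elim (≤⇒≯ (≤-reflexive (cong suc c2≡0)) 2≤c2+1)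
  ... | by-split₃ 2≤c3 _ = ⊥-elim (≤⇒≯ (≤-reflexive c3≡1) 2≤c3)

  allies-then-fork₂ : Offset 6 first j 0 → Win 6 T c j → Proper c → 8 ≤ c 1 →
                      (∀ {d} → Path 2 c d → Forkable d) → ⊥
  allies-then-fork₂ o w proper 8≤c1 forkable with allies-turn {m = 2} o ≤-refl w (≤-trans (m≤m+n 6 2) 8≤c1)
  ... | _ , d , o′ , π , w′ =
    fork₂ o′ w′ (path-proper π proper) (+-cancelˡ-≤ 4 4 (d 1) (≤-trans 8≤c1 (path-ones π))) (forkable π)

  F₂-after-split₁ : split₁ (ones (16 + u)) ≗ ones (14 + u) ⊕ 2
  F₂-after-split₁ = λ { 0 → refl ; 1 → refl ; 2 → refl ; (suc (suc (suc j))) → refl }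

  F₃-after-fuse₂ : fuse₂ (ones (16 + u)) ≗ ones (13 + u) ⊕ 3
  F₃-after-fuse₂ = λ { 0 → refl ; 1 → refl ; 2 → refl ; 3 → refl ; (suc (suc (suc (suc j)))) → refl }

  F₄-after-merge₂ : merge 2 (split₁ (ones (13 + u) ⊕ 3)) ≗ ones (11 + u) ⊕ 4
  F₄-after-merge₂ = λ { 0 → refl ; 1 → refl ; 2 → refl ; 3 → refl ; 4 → refl
                      ; (suc (suc (suc (suc (suc j))))) → refl }

  F₄-after-split₃ : split 3 (fuse₂ (fuse₂ (ones (16 + u)))) ≗ ones (11 + u) ⊕ 4
  F₄-after-split₃ = λ { 0 → refl ; 1 → refl ; 2 → refl ; 3 → refl ; 4 → refl
                      ; (suc (suc (suc (suc (suc j))))) → refl }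

  F₅-after-merge₃ : merge 3 (fuse₃ (ones (11 + u) ⊕ 4)) ≗ ones (8 + u) ⊕ 5
  F₅-after-merge₃ = λ { 0 → refl ; 1 → refl ; 2 → refl ; 3 → refl ; 4 → refl ; 5 → refl
                      ; (suc (suc (suc (suc (suc (suc j)))))) → refl }

  no-win-F₂F₃-free : Offset 6 first j 0 → Win 6 T c j → Proper c → Quiet c → c 2 ≡ 0 → c 3 ≡ 0 → 8 ≤ c 1 → ⊥
  no-win-F₂F₃-free o w proper quiet c2≡0 c3≡0 8≤c1 =
    allies-then-fork₂ o w proper 8≤c1 (forkable-after-two₀ quiet c2≡0 c3≡0)

  no-win-one-F₂ : Offset 6 first j 0 → Win 6 T (ones (14 + u) ⊕ 2) j → ⊥
  no-win-one-F₂ {u = u} o w =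
    allies-then-fork₂ o w refl (m≤m+n 8 (6 + u)) (forkable-after-two₁ (quiet-ones⊕ (14 + u) 2) refl refl refl)

  no-win-opponents-F₄ : Offset 6 first j 2 → Win 6 T (ones (11 + u) ⊕ 4) j → ⊥
  no-win-opponents-F₄ {u = u} o w with outsiders-turn o ≤-refl refl route w
    where
      route : Path 4 (ones (11 + u) ⊕ 4) (merge 3 (fuse₃ (ones (11 + u) ⊕ 4)))
      route = split₁-move (s≤s (s≤s z≤n)) ∷ split₁-move (s≤s (s≤s z≤n)) ∷ split₂-move (s≤s (s≤s z≤n)) ∷
              merge-move (s≤s z≤n) (s≤s z≤n) (s≤s z≤n) ∷ []
  ... | _ , o′ , w′ =
    no-win-F₂F₃-free o′ (win-resp w′ F₅-after-merge₃) refl (quiet-ones⊕ (8 + u) 5) refl refl (m≤m+n 8 u)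

  no-win-one-F₃ : Offset 6 first j 0 → Win 6 T (ones (13 + u) ⊕ 3) j → ⊥
  no-win-one-F₃ {u = u} o w with allies-turn {m = 2} o ≤-refl w (m≤m+n 6 (7 + u))
  ... | _ , d , o′ , π , w′ with forkable-after-two₃ (quiet-ones⊕ (13 + u) 3) refl refl refl π
  ... | inj₁ forkable =
    fork₂ o′ w′ (path-proper π refl) (+-cancelˡ-≤ 4 4 (d 1) (≤-trans (m≤m+n 8 (5 + u)) (path-ones π))) forkable
  ... | inj₂ d≗ = no-win-opponents-F₄ o′ (win-resp w′ (λ i → trans (d≗ i) (F₄-after-merge₂ i)))

  no-win-from-ones : ∀ ρ → Offset 6 first j ρ → ¬ Win 6 T (ones (16 + u)) j
  no-win-from-ones {u = u} 0 o w = no-win-F₂F₃-free o w refl (λ _ → z≤n , z≤n) refl refl (m≤m+n 8 (8 + u))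
  no-win-from-ones {u = u} 1 o w with allies-turn {m = 1} o ≤-refl w (m≤m+n 4 (12 + u))
  ... | _ , _ , o′ , mv ∷ [] , w′
    with outsiders-turn o′ ≤-refl refl route
           (win-resp w′ (forced-split₁ (λ _ → z≤n , z≤n) refl z≤n (inj₁ refl) mv))
    where
      route : Path 4 (split₁ (ones (16 + u))) (split 3 (fuse₂ (fuse₂ (ones (16 + u)))))
      route = merge-move ≤-refl (s≤s z≤n) (s≤s z≤n) ∷ split₁-move (s≤s (s≤s z≤n)) ∷
              merge-move ≤-refl (s≤s z≤n) (s≤s z≤n) ∷ split-move ≤-refl (s≤s (s≤s z≤n)) ∷ []
  ... | _ , o″ , w″ =
    no-win-F₂F₃-free o″ (win-resp w″ F₄-after-split₃) refl (quiet-ones⊕ (11 + u) 4) refl refl (m≤m+n 8 (3 + u))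
  no-win-from-ones {u = u} 2 o w with outsiders-turn o ≤-refl refl route w
    where
      route : Path 4 (ones (16 + u)) (merge 2 (split₁ (fuse₂ (ones (16 + u)))))
      route = split₁-move (s≤s (s≤s z≤n)) ∷ merge-move ≤-refl (s≤s z≤n) (s≤s z≤n) ∷
              split₁-move (s≤s (s≤s z≤n)) ∷ merge-move (s≤s z≤n) (s≤s z≤n) (s≤s z≤n) ∷ []
  ... | _ , o′ , w′ =
    no-win-F₂F₃-free o′ (win-resp w′ F₄) refl (quiet-ones⊕ (11 + u) 4) refl refl (m≤m+n 8 (3 + u))
    where
      F₄ : merge 2 (split₁ (fuse₂ (ones (16 + u)))) ≗ ones (11 + u) ⊕ 4
      F₄ i = trans (merge-cong 2 (split₁-cong F₃-after-fuse₂) i) (F₄-after-merge₂ i)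
  no-win-from-ones {u = u} 3 o w with outsiders-turn o (s≤s (s≤s z≤n)) refl (fuse₃-path 1 (m≤m+n 4 (12 + u))) w
  ... | _ , o′ , w′ = no-win-one-F₃ o′ (win-resp w′ F₃)
    where
      F₃ : fuse₃ (ones (16 + u)) ≗ ones (13 + u) ⊕ 3
      F₃ i = trans (sym (fuse₂≗fuse₃ {ones (16 + u)} (m≤m+n 4 (12 + u)) i)) (F₃-after-fuse₂ i)
  no-win-from-ones 4 o w with outsiders-turn o (s≤s (s≤s z≤n)) refl (fuse₂-path 1 (s≤s (s≤s (s≤s z≤n)))) w
  ... | _ , o′ , w′ = no-win-one-F₃ o′ (win-resp w′ F₃-after-fuse₂)
  no-win-from-ones 5 o w with outsiders-turn o (s≤s (s≤s z≤n)) refl (split₁-move (s≤s (s≤s z≤n)) ∷ []) w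
  ... | _ , o′ , w′ = no-win-one-F₂ o′ (win-resp w′ F₂-after-split₁)
  no-win-from-ones (suc (suc (suc (suc (suc (suc ρ)))))) (_ , s≤s (s≤s (s≤s (s≤s (s≤s (s≤s ())))))  , _)

  no-winning-strategy : 16 ≤ n → ¬ Win 6 T (ones n) 0
  no-winning-strategy 16≤n w with offset-of-zero first<p
  ... | ρ , o = no-win-from-ones ρ o (subst (λ n → Win 6 T (ones n) 0) (sym (proj₂ (m≤n⇒∃[o]m+o≡n 16≤n))) w)

large-team-sizes : ∀ e → (3 + e) * 4 ≤ (4 + e) * (3 + e) ×
                   (3 + e) * 4 + 2 + (4 + e) * (3 + e) ≤ 2 * (3 + e) * (3 + e) + 4 * (3 + e)
large-team-sizes e =
  ≤-trans (m≤m+n _ (e * (3 + e))) (≤-reflexive (players e)) ,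
  ≤-trans (m≤m+n _ (e * e + 5 * e + 4)) (≤-reflexive (ones-needed e))
  where
    players : ∀ e → (3 + e) * 4 + e * (3 + e) ≡ (4 + e) * (3 + e)
    players = solve-∀
    ones-needed : ∀ e → (3 + e) * 4 + 2 + (4 + e) * (3 + e) + (e * e + 5 * e + 4) ≡
                        2 * (3 + e) * (3 + e) + 4 * (3 + e)
    ones-needed = solve-∀

theorem1p3p2 : (t : ℕ) → 3 ≤ t → (n : ℕ) → 2 * (t ∸ 1) * (t ∸ 1) + 4 * (t ∸ 1) ≤ n →
    (team : ℕ → ℕ) → (∀ j → j < t * (t ∸ 1) → team j < t) →
    (∀ τ → τ < t → ConsecBlock (t * (t ∸ 1)) (t ∸ 1) (λ j → team j ≡ τ)) →
    ∀ τ → τ < t → ¬ Win (t * (t ∸ 1)) (λ j → team j ≡ τ) (start n) 0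
theorem1p3p2 0 () _ _ _ _ _ _ _
theorem1p3p2 1 (s≤s ()) _ _ _ _ _ _ _
theorem1p3p2 2 (s≤s (s≤s ())) _ _ _ _ _ _ _
theorem1p3p2 3 _ _ n-large _ _ blocks τ τ<t w =
  ThreeTeams.no-winning-strategy _ (blocks τ τ<t) n-large (win-resp w start≗ones)
theorem1p3p2 (suc (suc (suc (suc e)))) _ _ n-large _ _ blocks τ τ<t w =
  LargeTeam.no-winning-strategy _ _ _ (blocks τ τ<t) z<s (proj₁ (large-team-sizes e))
    (≤-trans (proj₂ (large-team-sizes e)) n-large) (win-resp w start≗ones)
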